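{- A finite, undirected, connected graph $\Gamma$ is 3-GNDB with $\gamma_\Gamma=1$ if and only if $\Gamma$ is isomorphic to $K_{1,3}$.
   Context: All graphs are finite, simple, undirected and connected, with at least one edge. For vertices $a,b$, $d(a,b)$ denotes the length of a shortest $a$–$b$ path. For an edge $ab$, $W_{ab}=\{x\in V(\Gamma)\mid d(x,a)<d(x,b)\}$. A graph $\Gamma$ is called generalized 3-nicely distance-balanced (3-GNDB) if there is a positive integer $\gamma_\Gamma$ such that for every edge $ab$ of $\Gamma$, one of $|W_{ab}|,|W_{ba}|$ equals $3$ times the other, and the smaller of the two equals $\gamma_\Gamma$. -}

module Defs where

open import Data.Nat using (ℕ; zero; suc; _<_; _*_)
import Data.Fin
open Data.Fin using (Fin)
open import Data.Fin.Subset using (Subset; _∈_; ∣_∣)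
open import Data.Product using (Σ; ∃; _×_; _,_)
open import Data.Sum using (_⊎_; inj₁; inj₂)
open import Relation.Nullary using (¬_)
open import Relation.Binary.PropositionalEquality using (_≡_; _≢_)
open import Function.Bundles using (_⇔_; _⤖_; Bijection)

record Graph : Set₁ where
  field
    n       : ℕ
    Adj     : Fin n → Fin n → Set
    sym     : ∀ {x y} → Adj x y → Adj y x
    irrefl  : ∀ {x} → ¬ Adj x x

module _ (G : Graph) where
  open Graph G

  data Walk : Fin n → Fin n → ℕ → Set where
    here  : ∀ {x} → Walk x x zero
    step  : ∀ {x y z k} → Adj x y → Walk y z k → Walk x z (suc k)

  Dist : Fin n → Fin n → ℕ → Set
  Dist x y k = Walk x y k × (∀ j → j < k → ¬ Walk x y j)

  Connected : Set
  Connected = ∀ x y → ∃ λ k → Walk x y k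

  HasEdge : Set
  HasEdge = ∃ λ x → ∃ λ y → Adj x y

  InW : Fin n → Fin n → Fin n → Set
  InW a b x = ∃ λ k → ∃ λ l → Dist x a k × Dist x b l × k < l

  CardW : Fin n → Fin n → ℕ → Set
  CardW a b m = Σ (Subset n) λ s → (∀ x → (x ∈ s) ⇔ InW a b x) × ∣ s ∣ ≡ m

  GNDB3 : ℕ → Set
  GNDB3 γ = ∀ a b → Adj a b →
    (CardW a b γ × CardW b a (3 * γ)) ⊎ (CardW b a γ × CardW a b (3 * γ))

Isomorphic : Graph → Graph → Set
Isomorphic G H =
  Σ (Fin (Graph.n G) ⤖ Fin (Graph.n H)) λ f →
    ∀ x y → Graph.Adj G x y ⇔ Graph.Adj H (Bijection.to f x) (Bijection.to f y)

K13Adj : Fin 4 → Fin 4 → Set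
K13Adj x y = (x ≡ Data.Fin.zero × y ≢ Data.Fin.zero) ⊎ (x ≢ Data.Fin.zero × y ≡ Data.Fin.zero)

K13 : Graph
K13 = record
  { n = 4
  ; Adj = K13Adj
  ; sym = λ { (inj₁ (p , q)) → inj₂ (q , p)
            ; (inj₂ (p , q)) → inj₁ (q , p) }
  ; irrefl = λ { (inj₁ (p , q)) → q p ; (inj₂ (p , q)) → p q }
  }

{-# OPTIONS --safe #-}
-- If |W_ab| = 1 then W_ab = {a}, so every neighbour of a other than b is adjacent to b: N[a] ⊆ N[b].
-- Take c with |N[c]| maximal. For a neighbour u of c, either N[c] ⊆ N[u], which by maximality forces
-- N[u] = N[c], or every neighbour of u lies in N[c]; so N[c] is closed under adjacency and, by
-- connectivity, c is adjacent to every other vertex. Then W_yc = {y} for every y ≠ c, hence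
-- |W_cy| = 3; an edge yz with z dominated by y would give W_cy ⊊ W_cz, so there are no edges besides
-- those at c, and |W_cy| = n − 1 = 3.
module Submission where

open import Defs
open import Data.Bool.Properties using (T-≡)
open import Data.Nat using (ℕ; zero; suc; _<_; _≤_; _∸_; z≤n; s≤s)
import Data.Nat.Properties as ℕ
open import Data.Fin using (Fin; _≟_)
import Data.Fin as Fin
open import Data.Fin.Properties using (any?; cantor-schröder-bernstein)
open import Data.Fin.Permutation using (transpose)
import Data.Fin.Permutation.Components as Transposition
open import Data.Fin.Subset using (Subset; _∈_; ∣_∣; ⁅_⁆; ∁)
open import Data.Fin.Subset.Properties
  using (x∈⁅x⁆; x∈⁅y⁆⇒x≡y; x≢y⇒x∉⁅y⁆; x∉⁅y⁆⇒x≢y; ∣⁅x⁆∣≡1; ∣∁p∣≡n∸∣p∣;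
         x∈∁p⇒x∉p; x∉p⇒x∈∁p; p⊆q⇒∣p∣≤∣q∣; p⊂q⇒∣p∣<∣q∣)
open import Data.List using (allFin)
open import Data.List.Extrema.Nat using (argmax; f[xs]≤f[argmax])
open import Data.List.Membership.Propositional.Properties using (∈-allFin)
import Data.List.Relation.Unary.All as All
open import Data.Vec using (tabulate)
open import Data.Vec.Properties using (lookup∘tabulate; []=⇒lookup; lookup⇒[]=)
open import Data.Product using (Σ; ∃; _×_; _,_; proj₂)
open import Data.Sum using (_⊎_; inj₁; inj₂; [_,_])
open import Data.Empty using (⊥)
open import Function using (_∘_)
open import Function.Bundles using (_⇔_; mk⇔; Equivalence; _⤖_; Bijection; Surjection)
import Function.Properties.Equivalence as ⇔
open import Function.Properties.Inverse using (↔⇒⤖)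
open import Relation.Nullary using (¬_; Dec; yes; no; isYes)
open import Relation.Nullary.Decidable
  using (¬?; _×-dec_; _⊎-dec_; decidable-stable; ¬¬-excluded-middle; dec-true; toWitness; fromWitness)
open import Relation.Nullary.Negation using (¬¬-map; contradiction)
open import Relation.Unary using (Decidable)
open import Relation.Binary.PropositionalEquality
  using (_≡_; _≢_; refl; sym; trans; cong; subst)
open import Relation.Binary.Definitions using (tri<; tri≈; tri>)

open Equivalence using (to; from)

¬¬-pull-Fin : ∀ {n} {P : Fin n → Set} → (∀ i → ¬ ¬ P i) → ¬ ¬ (∀ i → P i)
¬¬-pull-Fin {zero}  ¬¬P ¬∀P = ¬∀P (λ ())
¬¬-pull-Fin {suc n} ¬¬P ¬∀P = ¬¬P Fin.zero λ P₀ →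
  ¬¬-pull-Fin (¬¬P ∘ Fin.suc) λ P₊ → ¬∀P λ { Fin.zero → P₀ ; (Fin.suc i) → P₊ i }

module _ {n : ℕ} where

  HasSize : (Fin n → Set) → ℕ → Set
  HasSize P m = Σ (Subset n) λ s → (∀ x → x ∈ s ⇔ P x) × ∣ s ∣ ≡ m

  HasSize-resp : ∀ {P Q m} → (∀ x → P x ⇔ Q x) → HasSize P m → HasSize Q m
  HasSize-resp P⇔Q (s , s⇔P , ∣s∣) = s , (λ x → ⇔.trans (s⇔P x) (P⇔Q x)) , ∣s∣

  HasSize-mono : ∀ {P Q m m'} → (∀ {x} → P x → Q x) →
                 HasSize P m → HasSize Q m' → m ≤ m'
  HasSize-mono P⊆Q (s , s⇔P , refl) (t , t⇔Q , refl) =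
    p⊆q⇒∣p∣≤∣q∣ λ {x} x∈s → from (t⇔Q x) (P⊆Q (to (s⇔P x) x∈s))

  HasSize-strictMono : ∀ {P Q m m' w} → (∀ {x} → P x → Q x) → Q w → ¬ P w →
                       HasSize P m → HasSize Q m' → m < m'
  HasSize-strictMono {w = w} P⊆Q Qw ¬Pw (s , s⇔P , refl) (t , t⇔Q , refl) =
    p⊂q⇒∣p∣<∣q∣ ( (λ {x} x∈s → from (t⇔Q x) (P⊆Q (to (s⇔P x) x∈s)))
                , w , from (t⇔Q w) Qw , ¬Pw ∘ to (s⇔P w))

  HasSize-unique : ∀ {P m m'} → HasSize P m → HasSize P m' → m ≡ m'
  HasSize-unique Pm Pm' = ℕ.≤-antisym (HasSize-mono (λ p → p) Pm Pm')
                                       (HasSize-mono (λ p → p) Pm' Pm)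

  HasSize-singleton : ∀ y → HasSize (_≡ y) 1
  HasSize-singleton y =
    ⁅ y ⁆ , (λ x → mk⇔ (x∈⁅y⁆⇒x≡y y) λ { refl → x∈⁅x⁆ y }) , ∣⁅x⁆∣≡1 y

  HasSize-allBut : ∀ y → HasSize (_≢ y) (n ∸ 1)
  HasSize-allBut y =
    ∁ ⁅ y ⁆ , (λ x → mk⇔ (x∉⁅y⁆⇒x≢y ∘ x∈∁p⇒x∉p) (x∉p⇒x∈∁p ∘ x≢y⇒x∉⁅y⁆)) ,
    trans (∣∁p∣≡n∸∣p∣ ⁅ y ⁆) (cong (n ∸_) (∣⁅x⁆∣≡1 y))

  HasSize-≤1 : ∀ {P m} y → (∀ {x} → P x → x ≡ y) → HasSize P m → m ≤ 1
  HasSize-≤1 y P⊆⁅y⁆ Pm = HasSize-mono P⊆⁅y⁆ Pm (HasSize-singleton y)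

  HasSize-1⇒≡ : ∀ {P x y} → HasSize P 1 → P x → P y → x ≡ y
  HasSize-1⇒≡ {x = x} {y} P1 Px Py with x ≟ y
  ... | yes x≡y = x≡y
  ... | no  x≢y = contradiction
    (HasSize-strictMono (λ { refl → Py }) Px x≢y (HasSize-singleton y) P1)
    (ℕ.<-irrefl refl)

  toSubset : ∀ {P : Fin n → Set} → Decidable P → Subset n
  toSubset P? = tabulate (isYes ∘ P?)

  ∈-toSubset : ∀ {P : Fin n → Set} (P? : Decidable P) x → x ∈ toSubset P? ⇔ P x
  ∈-toSubset P? x = mk⇔
    (λ x∈ → toWitness (from T-≡ (trans (sym (lookup∘tabulate _ x)) ([]=⇒lookup x∈))))
    (λ Px → lookup⇒[]= x _ (trans (lookup∘tabulate _ x) (to T-≡ (fromWitness Px))))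

  size : ∀ {P : Fin n → Set} → Decidable P → ℕ
  size P? = ∣ toSubset P? ∣

  HasSize-size : ∀ {P : Fin n → Set} (P? : Decidable P) → HasSize P (size P?)
  HasSize-size P? = toSubset P? , ∈-toSubset P? , refl

Star : ∀ {m} → Fin m → Fin m → Fin m → Set
Star c x y = (x ≡ c × y ≢ c) ⊎ (x ≢ c × y ≡ c)

star? : ∀ {m} (c x y : Fin m) → Dec (Star c x y)
star? c x y = ((x ≟ c) ×-dec ¬? (y ≟ c)) ⊎-dec (¬? (x ≟ c) ×-dec (y ≟ c))

Star-relabel : ∀ {m k} {f : Fin m → Fin k} {c c'} →
               (∀ {x y} → f x ≡ f y → x ≡ y) → f c ≡ c' →
               ∀ x y → Star c x y ⇔ Star c' (f x) (f y)
Star-relabel {f = f} {c} {c'} f-inj fc≡c' x y = mk⇔ forth back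
  where
  centre⇔ : ∀ z → z ≡ c ⇔ f z ≡ c'
  centre⇔ z = mk⇔ (λ { refl → fc≡c' }) (λ fz≡c' → f-inj (trans fz≡c' (sym fc≡c')))

  forth : Star c x y → Star c' (f x) (f y)
  forth (inj₁ (x≡c , y≢c)) = inj₁ (to (centre⇔ x) x≡c , y≢c ∘ from (centre⇔ y))
  forth (inj₂ (x≢c , y≡c)) = inj₂ (x≢c ∘ from (centre⇔ x) , to (centre⇔ y) y≡c)

  back : Star c' (f x) (f y) → Star c x y
  back (inj₁ (x≡c , y≢c)) = inj₁ (from (centre⇔ x) x≡c , y≢c ∘ to (centre⇔ y))
  back (inj₂ (x≢c , y≡c)) = inj₂ (x≢c ∘ to (centre⇔ x) , from (centre⇔ y) y≡c)

centring-bijection : ∀ {m} → m ≡ 4 → (c : Fin m) →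
                     Σ (Fin m ⤖ Fin 4) λ f → Bijection.to f c ≡ Fin.zero
centring-bijection refl c = ↔⇒⤖ (transpose c Fin.zero) , c↦0
  where
  c↦0 : Transposition.transpose c Fin.zero c ≡ Fin.zero
  c↦0 rewrite dec-true (c ≟ c) refl = refl

module GraphProperties (G : Graph) where
  open Graph G renaming (sym to Adj-sym)

  N[_] : Fin n → Fin n → Set
  N[ x ] z = z ≡ x ⊎ Adj x z

  _DominatedBy_ : Fin n → Fin n → Set
  a DominatedBy b = ∀ {w} → Adj a w → N[ b ] w

  Universal : Fin n → Set
  Universal c = ∀ x → x ≢ c → Adj c x

  IsStar : Fin n → Set
  IsStar c = ∀ x y → Adj x y ⇔ Star c x y

  walk-zero : ∀ {x y} → Walk G x y 0 → x ≡ y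
  walk-zero here = refl

  walk-one : ∀ {x y} → Walk G x y 1 → Adj x y
  walk-one (step xy here) = xy

  walk-snoc : ∀ {x y z k} → Walk G x y k → Adj y z → Walk G x z (suc k)
  walk-snoc here         yz = step yz here
  walk-snoc (step xw wy) yz = step xw (walk-snoc wy yz)

  walk-reverse : ∀ {x y k} → Walk G x y k → Walk G y x k
  walk-reverse here         = here
  walk-reverse (step xw wy) = walk-snoc (walk-reverse wy) (Adj-sym xw)

  dist-unique : ∀ {x y k l} → Dist G x y k → Dist G x y l → k ≡ l
  dist-unique {k = k} {l} (xy₁ , min₁) (xy₂ , min₂) with ℕ.<-cmp k l
  ... | tri< k<l _ _ = contradiction xy₁ (min₂ k k<l)
  ... | tri≈ _ k≡l _ = k≡l
  ... | tri> _ _ l<k = contradiction xy₂ (min₁ l l<k)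

  dist-refl : ∀ {x} → Dist G x x 0
  dist-refl = here , λ _ ()

  dist-adj : ∀ {x y} → Adj x y → Dist G x y 1
  dist-adj {x} xy = step xy here , λ
    { zero _ xy₀ → irrefl (subst (Adj x) (sym (walk-zero xy₀)) xy) ; (suc _) (s≤s ()) }

  dist-two : ∀ {x z y} → Adj x z → Adj z y → x ≢ y → ¬ Adj x y → Dist G x y 2
  dist-two xz zy x≢y ¬xy = step xz (step zy here) , λ
    { zero _ w → x≢y (walk-zero w) ; (suc zero) _ w → ¬xy (walk-one w)
    ; (suc (suc _)) (s≤s (s≤s ())) }

  InW-self : ∀ {a b} → Adj a b → InW G a b a
  InW-self ab = 0 , 1 , dist-refl , dist-adj ab , s≤s z≤n

  InW-privateNeighbour : ∀ {a b z} → Adj a b → Adj a z → z ≢ b → ¬ Adj z b → InW G a b z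
  InW-privateNeighbour ab az z≢b ¬zb =
    1 , 2 , dist-adj (Adj-sym az) , dist-two (Adj-sym az) ab z≢b ¬zb , s≤s (s≤s z≤n)

  -- The last step of a shortest walk from x to a comes from a vertex of N[ b ], so d(x,b) ≤ d(x,a).
  InW-dominated : ∀ {a b} → a DominatedBy b → ∀ {x} → InW G a b x → x ≡ a
  InW-dominated a≼b (zero , _ , (xa , _) , _) = walk-zero xa
  InW-dominated a≼b (suc k , l , (xa , _) , (_ , minb) , k<l) with walk-reverse xa
  ... | step av vx with a≼b av
  ...   | inj₁ refl = contradiction (walk-reverse vx) (minb k (ℕ.<-trans (ℕ.n<1+n k) k<l))
  ...   | inj₂ bv   = contradiction (walk-reverse (step bv vx)) (minb (suc k) k<l)

  InW-universal : ∀ {c y} → Universal c → y ≢ c →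
                  ∀ x → InW G c y x ⇔ (x ≡ c ⊎ (x ≢ y × ¬ Adj x y))
  InW-universal {c} {y} univ y≢c x = mk⇔ forth back
    where
    forth : InW G c y x → (x ≡ c ⊎ (x ≢ y × ¬ Adj x y))
    forth (k , l , xc , xy , k<l) with x ≟ c
    ... | yes x≡c = inj₁ x≡c
    ... | no  x≢c with dist-unique xc (dist-adj (Adj-sym (univ x x≢c)))
    ... | refl = inj₂ ( (λ { refl → ℕ.<⇒≢ (ℕ.<-trans (s≤s z≤n) k<l) (sym (dist-unique xy dist-refl)) })
                      , (λ xy' → ℕ.<⇒≢ k<l (sym (dist-unique xy (dist-adj xy')))) )
    back : (x ≡ c ⊎ (x ≢ y × ¬ Adj x y)) → InW G c y x
    back (inj₁ refl) = InW-self (univ y y≢c)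
    back (inj₂ (x≢y , ¬xy)) with x ≟ c
    ... | yes refl = InW-self (univ y y≢c)
    ... | no  x≢c  = 1 , 2 , dist-adj (Adj-sym (univ x x≢c)) ,
                     dist-two (Adj-sym (univ x x≢c)) (univ y y≢c) x≢y ¬xy , s≤s (s≤s z≤n)

  N? : (∀ x y → Dec (Adj x y)) → ∀ x → Decidable N[ x ]
  N? Adj? x z = (z ≟ x) ⊎-dec Adj? x z

  ¬¬-Adj-decidable : ¬ ¬ (∀ x y → Dec (Adj x y))
  ¬¬-Adj-decidable = ¬¬-pull-Fin λ x → ¬¬-pull-Fin λ y → ¬¬-excluded-middle

  walk-preserves : ∀ {P : Fin n → Set} → (∀ {u v} → P u → Adj u v → P v) →
                   ∀ {x y k} → Walk G x y k → P x → P y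
  walk-preserves closed here         Px = Px
  walk-preserves closed (step xw wy) Px = walk-preserves closed wy (closed Px xw)

  N-closed⇒universal : Connected G → ∀ {c} → (∀ {u v} → N[ c ] u → Adj u v → N[ c ] v) →
                       Universal c
  N-closed⇒universal conn {c} closed x x≢c
    with walk-preserves closed (proj₂ (conn c x)) (inj₁ refl)
  ... | inj₁ x≡c = contradiction x≡c x≢c
  ... | inj₂ cx  = cx

  universal⇒dominates : ∀ {c} → Universal c → ∀ y → y DominatedBy c
  universal⇒dominates {c} univ y {w} _ with w ≟ c
  ... | yes w≡c = inj₁ w≡c
  ... | no  w≢c = inj₂ (univ w w≢c)

  dominated⇒N⊆N : ∀ {a b} → Adj a b → a DominatedBy b → ∀ {z} → N[ a ] z → N[ b ] z
  dominated⇒N⊆N ab a≼b (inj₁ refl) = inj₂ (Adj-sym ab)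
  dominated⇒N⊆N ab a≼b (inj₂ az)   = a≼b az

  W-trivial⇒dominated : (∀ x y → Dec (Adj x y)) → ∀ {a b} → Adj a b → CardW G a b 1 → a DominatedBy b
  W-trivial⇒dominated Adj? {a} {b} ab Wab=1 {w} aw with w ≟ b | Adj? b w
  ... | yes w≡b | _      = inj₁ w≡b
  ... | no  _   | yes bw = inj₂ bw
  ... | no  w≢b | no ¬bw = contradiction (subst (Adj a) w≡a aw) irrefl
    where
    w≡a : w ≡ a
    w≡a = HasSize-1⇒≡ Wab=1 (InW-privateNeighbour ab aw w≢b (¬bw ∘ Adj-sym)) (InW-self ab)

  leaves-nonadjacent⇒Star : ∀ {c} → (∀ {x y} → x ≢ c → y ≢ c → ¬ Adj x y) →
                            ∀ {x y} → Adj x y → Star c x y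
  leaves-nonadjacent⇒Star {c} leaves {x} {y} xy with x ≟ c | y ≟ c
  ... | yes refl | _        = inj₁ (refl , λ { refl → irrefl xy })
  ... | no  x≢c  | yes y≡c  = inj₂ (x≢c , y≡c)
  ... | no  x≢c  | no  y≢c  = contradiction xy (leaves x≢c y≢c)

  edges-at-centre⇒star : Connected G → ∀ {c} → (∀ {x y} → Adj x y → Star c x y) → IsStar c
  edges-at-centre⇒star conn {c} at-c x y = mk⇔ at-c star⇒Adj
    where
    closed : ∀ {u v} → N[ c ] u → Adj u v → N[ c ] v
    closed (inj₁ refl) cv = inj₂ cv
    closed (inj₂ cu)   uv with at-c uv
    ... | inj₁ (u≡c , _) = contradiction (subst (Adj c) u≡c cu) irrefl
    ... | inj₂ (_ , v≡c) = inj₁ v≡c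

    univ : Universal c
    univ = N-closed⇒universal conn closed

    star⇒Adj : Star c x y → Adj x y
    star⇒Adj (inj₁ (refl , y≢c)) = univ y y≢c
    star⇒Adj (inj₂ (x≢c , refl)) = Adj-sym (univ x x≢c)

  module _ {c} (star : IsStar c) where

    star-universal : Universal c
    star-universal x x≢c = from (star c x) (inj₁ (refl , x≢c))

    star-leaves : ∀ {x y} → x ≢ c → y ≢ c → ¬ Adj x y
    star-leaves x≢c y≢c xy with to (star _ _) xy
    ... | inj₁ (x≡c , _) = x≢c x≡c
    ... | inj₂ (_ , y≡c) = y≢c y≡c

    CardW-leaf-centre : ∀ {y} → y ≢ c → CardW G y c 1
    CardW-leaf-centre {y} y≢c = HasSize-resp singleton⇔W (HasSize-singleton y)
      where
      singleton⇔W : ∀ x → x ≡ y ⇔ InW G y c x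
      singleton⇔W x = mk⇔ (λ { refl → InW-self (Adj-sym (star-universal y y≢c)) })
                          (InW-dominated (universal⇒dominates star-universal y))

    CardW-centre-leaf : ∀ {y} → y ≢ c → CardW G c y (n ∸ 1)
    CardW-centre-leaf {y} y≢c = HasSize-resp allBut⇔W (HasSize-allBut y)
      where
      allBut⇔W : ∀ x → x ≢ y ⇔ InW G c y x
      allBut⇔W x = ⇔.trans (mk⇔ forth back) (⇔.sym (InW-universal star-universal y≢c x))
        where
        forth : x ≢ y → x ≡ c ⊎ (x ≢ y × ¬ Adj x y)
        forth x≢y with x ≟ c
        ... | yes x≡c = inj₁ x≡c
        ... | no  x≢c = inj₂ (x≢y , star-leaves x≢c y≢c)
        back : x ≡ c ⊎ (x ≢ y × ¬ Adj x y) → x ≢ y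
        back (inj₁ refl)     refl = y≢c refl
        back (inj₂ (x≢y , _))     = x≢y

    star⇒GNDB3 : n ≡ 4 → GNDB3 G 1
    star⇒GNDB3 n≡4 a b ab = orient (to (star a b) ab)
      where
      leaf-sizes : ∀ {y} → y ≢ c → CardW G y c 1 × CardW G c y 3
      leaf-sizes y≢c =
        CardW-leaf-centre y≢c , subst (CardW G c _) (cong (_∸ 1) n≡4) (CardW-centre-leaf y≢c)

      orient : Star c a b → (CardW G a b 1 × CardW G b a 3) ⊎ (CardW G b a 1 × CardW G a b 3)
      orient (inj₁ (refl , b≢c)) = inj₂ (leaf-sizes b≢c)
      orient (inj₂ (a≢c , refl)) = inj₁ (leaf-sizes a≢c)

module GNDB3-γ=1 (G : Graph) (conn : Connected G) (gndb : GNDB3 G 1) where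
  open Graph G renaming (sym to Adj-sym)
  open GraphProperties G

  module _ (Adj? : ∀ x y → Dec (Adj x y)) where

    deg : Fin n → ℕ
    deg x = size (N? Adj? x)

    module _ (v₀ : Fin n) where

      centre : Fin n
      centre = argmax deg v₀ (allFin n)

      deg≤deg-centre : ∀ x → deg x ≤ deg centre
      deg≤deg-centre x = All.lookup (f[xs]≤f[argmax] {f = deg} v₀ (allFin n)) (∈-allFin x)

      -- One endpoint of the edge c u is dominated: if it is c, then N[ c ] ⊆ N[ u ] and maximality of deg c
      -- forbids v ∉ N[ c ]; if it is u, then v ∈ N[ c ] directly.
      N-centre-closed : ∀ {u v} → N[ centre ] u → Adj u v → N[ centre ] v
      N-centre-closed (inj₁ refl) cv = inj₂ cv
      N-centre-closed {u} {v} (inj₂ cu) uv with gndb centre u cu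
      ... | inj₂ (Wuc=1 , _) = W-trivial⇒dominated Adj? (Adj-sym cu) Wuc=1 uv
      ... | inj₁ (Wcu=1 , _) = decidable-stable (N? Adj? centre v) λ v∉N[c] →
        ℕ.<⇒≱ (HasSize-strictMono (dominated⇒N⊆N cu (W-trivial⇒dominated Adj? cu Wcu=1)) (inj₂ uv) v∉N[c]
                                  (HasSize-size (N? Adj? centre)) (HasSize-size (N? Adj? u)))
              (deg≤deg-centre u)

      centre-universal : Universal centre
      centre-universal = N-closed⇒universal conn N-centre-closed

      CardW-centre-leaf-3 : ∀ {y} → y ≢ centre → CardW G centre y 3
      CardW-centre-leaf-3 {y} y≢c with gndb centre y (centre-universal y y≢c)
      ... | inj₂ (_ , Wcy=3) = Wcy=3
      ... | inj₁ (_ , Wyc=3) = contradiction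
        (HasSize-≤1 y (InW-dominated (universal⇒dominates centre-universal y)) Wyc=3) λ { (s≤s ()) }

      -- Domination of z by y gives W_cy ⊆ W_cz, and since |W_yz| = 3 the vertex y is not dominated by z:
      -- a witness w ∈ N(y) ∖ N[z] lies in W_cz ∖ W_cy, contradicting |W_cy| = |W_cz| = 3.
      dominated-leaf-edge : ∀ {y z} → y ≢ centre → z ≢ centre → Adj y z →
                            CardW G z y 1 → CardW G y z 3 → ⊥
      dominated-leaf-edge {y} {z} y≢c z≢c yz Wzy=1 Wyz=3
        with any? (λ w → Adj? y w ×-dec ¬? (N? Adj? z w))
      ... | no ∄w = contradiction (HasSize-≤1 y (InW-dominated y≼z) Wyz=3) λ { (s≤s ()) }
        where
        y≼z : y DominatedBy z
        y≼z {w} yw = decidable-stable (N? Adj? z w) λ w∉N[z] → ∄w (w , yw , w∉N[z])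
      ... | yes (w , yw , w∉N[z]) = ℕ.<-irrefl refl
        (HasSize-strictMono Wcy⊆Wcz w∈Wcz w∉Wcy (CardW-centre-leaf-3 y≢c) (CardW-centre-leaf-3 z≢c))
        where
        W-centre : ∀ {y} → y ≢ centre → ∀ x → InW G centre y x ⇔ (x ≡ centre ⊎ (x ≢ y × ¬ Adj x y))
        W-centre = InW-universal centre-universal

        Wcy⊆Wcz : ∀ {x} → InW G centre y x → InW G centre z x
        Wcy⊆Wcz {x} x∈Wcy with to (W-centre y≢c x) x∈Wcy
        ... | inj₁ x≡c = from (W-centre z≢c x) (inj₁ x≡c)
        ... | inj₂ (x≢y , ¬xy) = from (W-centre z≢c x) (inj₂ (x≢z , ¬xz))
          where
          x≢z : x ≢ z
          x≢z refl = ¬xy (Adj-sym yz)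
          ¬xz : ¬ Adj x z
          ¬xz xz = [ x≢y , ¬xy ∘ Adj-sym ] (W-trivial⇒dominated Adj? (Adj-sym yz) Wzy=1 (Adj-sym xz))

        w∈Wcz : InW G centre z w
        w∈Wcz = from (W-centre z≢c w) (inj₂ (w∉N[z] ∘ inj₁ , w∉N[z] ∘ inj₂ ∘ Adj-sym))

        w∉Wcy : ¬ InW G centre y w
        w∉Wcy w∈Wcy with to (W-centre y≢c w) w∈Wcy
        ... | inj₁ refl       = w∉N[z] (inj₂ (Adj-sym (centre-universal z z≢c)))
        ... | inj₂ (_ , ¬wy) = ¬wy (Adj-sym yw)

      leaves-nonadjacent : ∀ {y z} → y ≢ centre → z ≢ centre → ¬ Adj y z
      leaves-nonadjacent y≢c z≢c yz with gndb _ _ yz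
      ... | inj₁ (Wyz=1 , Wzy=3) = dominated-leaf-edge z≢c y≢c (Adj-sym yz) Wyz=1 Wzy=3
      ... | inj₂ (Wzy=1 , Wyz=3) = dominated-leaf-edge y≢c z≢c yz Wzy=1 Wyz=3

      centre≡dominating-end : ∀ {a b} → Adj a b → CardW G b a 1 → centre ≡ a
      centre≡dominating-end {a} {b} ab Wba=1 with a ≟ centre
      ... | yes a≡c = sym a≡c
      ... | no  a≢c with b ≟ centre
      ...   | no  b≢c = contradiction ab (leaves-nonadjacent a≢c b≢c)
      ...   | yes b≡c = contradiction
        (HasSize-unique (subst (λ t → CardW G t a 1) b≡c Wba=1) (CardW-centre-leaf-3 a≢c)) λ ()

      edges-at-dominating-end : ∀ {a b} → Adj a b → CardW G b a 1 → ∀ {x y} → Adj x y → Star a x y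
      edges-at-dominating-end ab Wba=1 xy =
        subst (λ c → Star c _ _) (centre≡dominating-end ab Wba=1)
              (leaves-nonadjacent⇒Star leaves-nonadjacent xy)

  -- Adjacency is decidable only up to double negation, but the conclusion Star a x y is decidable, hence stable.
  GNDB3⇒star : ∀ {a b} → Adj a b → CardW G b a 1 → CardW G a b 3 → n ≡ 4 × ∃ IsStar
  GNDB3⇒star {a} {b} ab Wba=1 Wab=3 = n≡4 , a , star
    where
    edges-at-a : ∀ {x y} → Adj x y → Star a x y
    edges-at-a {x} {y} xy = decidable-stable (star? a x y)
      (¬¬-map (λ Adj? → edges-at-dominating-end Adj? a ab Wba=1 xy) ¬¬-Adj-decidable)

    star : IsStar a
    star = edges-at-centre⇒star conn edges-at-a

    pred≡3⇒≡4 : ∀ {m} → Fin m → m ∸ 1 ≡ 3 → m ≡ 4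
    pred≡3⇒≡4 {suc _} _ refl = refl

    n≡4 : n ≡ 4
    n≡4 = pred≡3⇒≡4 a (HasSize-unique (CardW-centre-leaf star λ { refl → irrefl ab }) Wab=3)

isomorphic-K13⇔star : (G : Graph) →
                      Isomorphic G K13 ⇔ (Graph.n G ≡ 4 × ∃ (GraphProperties.IsStar G))
isomorphic-K13⇔star G = mk⇔ forth back
  where
  open Graph G using (n)
  open GraphProperties G using (IsStar)

  forth : Isomorphic G K13 → n ≡ 4 × ∃ IsStar
  forth (f , f-iso) = cantor-schröder-bernstein to-injective to⁻-injective , to⁻ Fin.zero , star
    where
    open Bijection f using (to⁻; surjection) renaming (to to f⃗; injective to to-injective)
    open Surjection surjection using (to∘to⁻)
    to⁻-injective : ∀ {x y} → to⁻ x ≡ to⁻ y → x ≡ y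
    to⁻-injective {x} {y} eq = trans (sym (to∘to⁻ x)) (trans (cong f⃗ eq) (to∘to⁻ y))
    star : IsStar (to⁻ Fin.zero)
    star x y = ⇔.trans (f-iso x y) (⇔.sym (Star-relabel to-injective (to∘to⁻ Fin.zero) x y))

  back : n ≡ 4 × ∃ IsStar → Isomorphic G K13
  back (n≡4 , c , star) with centring-bijection n≡4 c
  ... | f , fc≡0 = f , λ x y → ⇔.trans (star x y) (Star-relabel (Bijection.injective f) fc≡0 x y)

mainTheorem5 : (G : Graph) → Connected G → HasEdge G →
    (GNDB3 G 1 ⇔ Isomorphic G K13)
mainTheorem5 G conn (a , b , ab) = ⇔.trans (mk⇔ forth back) (⇔.sym (isomorphic-K13⇔star G))
  where
  forth : GNDB3 G 1 → Graph.n G ≡ 4 × ∃ (GraphProperties.IsStar G)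
  forth gndb with gndb a b ab
  ... | inj₁ (Wab=1 , Wba=3) = GNDB3-γ=1.GNDB3⇒star G conn gndb (Graph.sym G ab) Wab=1 Wba=3
  ... | inj₂ (Wba=1 , Wab=3) = GNDB3-γ=1.GNDB3⇒star G conn gndb ab Wba=1 Wab=3

  back : Graph.n G ≡ 4 × ∃ (GraphProperties.IsStar G) → GNDB3 G 1
  back (n≡4 , c , star) = GraphProperties.star⇒GNDB3 G star n≡4
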